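{- Let $n\in\mathbb{N}$ and let $\alpha$ be a composition with $\ell(\alpha)\le n$. (1) The set of quasi-ribbon words in $\mathcal{A}_n^*$ whose quasi-ribbon tableaux have shape $\alpha$ forms a single connected component of the quasi-crystal graph $\Gamma_n$. (2) In this connected component there is a unique highest-weight word, namely the column reading of the quasi-ribbon tableau of shape $\alpha$ whose $j$-th row consists entirely of symbols $j$, for $j=1,\dots,\ell(\alpha)$.
   Context: $\mathcal{A}_n=\{1<\dots<n\}$. A composition $\alpha=(\alpha_1,\dots,\alpha_k)$ has positive parts and length $\ell(\alpha)=k$. A ribbon diagram of shape $\alpha$ has $\alpha_h$ boxes in row $h$, leftmost box of each row directly below the rightmost box of the previous row. A quasi-ribbon tableau is such a diagram filled with positive integers, rows weakly increasing left to right, columns strictly increasing top to bottom. Its column reading reads columns left to right, each from bottom to top; a quasi-ribbon word is the column reading of a quasi-ribbon tableau (which is then uniquely determined by the word and called its quasi-ribbon tableau). A word $u$ has an $i$-inversion if it contains a letter $i+1$ to the left of a letter $i$. Quasi-Kashiwara operators: if $u$ has an $i$-inversion, $e_i(u),f_i(u)$ are undefined; otherwise $e_i(u)$ replaces the leftmost letter $i+1$ by $i$ (undefined if none), and $f_i(u)$ replaces the rightmost letter $i$ by $i+1$ (undefined if none). The quasi-crystal graph $\Gamma_n$ has vertex set $\mathcal{A}_n^*$ and an edge $u\to f_i(u)$ labelled $i$ whenever defined ($i=1,\dots,n-1$). A word is highest-weight if no $e_i$ ($i=1,\dots,n-1$) is defined on it. -}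

module Defs where

open import Data.Nat using (ℕ; zero; suc; _+_; _∸_; _≤_; _<_; _≟_)
open import Data.List using (List; []; _∷_; _++_; length; map; filter; reverse; upTo; zipWith; replicate; concatMap)
open import Data.List.Membership.Propositional using (_∈_)
open import Data.List.Relation.Unary.All using (All)
open import Data.Maybe using (Maybe; just; nothing)
open import Data.Product using (Σ; ∃; _×_; _,_; proj₁; proj₂)
open import Data.Bool using (if_then_else_)
open import Relation.Nullary using (¬_; does)
open import Relation.Binary.PropositionalEquality using (_≡_)
open import Relation.Binary.Construct.Closure.ReflexiveTransitive using (Star)
open import Relation.Binary.Construct.Closure.Symmetric using (SymClosure)

Word : Set
Word = List ℕ

InAlph : ℕ → Word → Set
InAlph n w = All (λ a → 1 ≤ a × a ≤ n) w

IsComposition : List ℕ → Set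
IsComposition α = All (λ a → 1 ≤ a) α

-- Ribbon diagrams / quasi-ribbon tableaux.
-- A filled ribbon diagram is given by its list of rows (top to bottom).
Tableau : Set
Tableau = List (List ℕ)

shape : Tableau → List ℕ
shape T = map length T

-- Row h starts in column c_h with
-- c_0 = 0, c_{h+1} = c_h + α_h - 1 (leftmost box of row h+1 directly
-- below the rightmost box of row h).
Cell : Set
Cell = ℕ × ℕ × ℕ

cellsFrom : ℕ → ℕ → Tableau → List Cell
cellsFrom c h [] = []
cellsFrom c h (r ∷ rs) =
  zipWith (λ j x → (c + j , h , x)) (upTo (length r)) r
  ++ cellsFrom (c + length r ∸ 1) (suc h) rs

cells : Tableau → List Cell
cells T = cellsFrom 0 0 T

col : Cell → ℕ
col = proj₁

row : Cell → ℕ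
row c = proj₁ (proj₂ c)

entry : Cell → ℕ
entry c = proj₂ (proj₂ c)

columnReading : Tableau → Word
columnReading T =
  concatMap (λ c → reverse (map entry (filter (λ p → col p ≟ c) (cells T))))
            (upTo (length (cells T)))

record IsQuasiRibbonTableau (T : Tableau) : Set where
  field
    shapeComp : IsComposition (shape T)
    positive  : ∀ {p} → p ∈ cells T → 1 ≤ entry p
    rowsWeak  : ∀ {p q} → p ∈ cells T → q ∈ cells T →
                row p ≡ row q → col p < col q → entry p ≤ entry q
    colsStrict : ∀ {p q} → p ∈ cells T → q ∈ cells T →
                col p ≡ col q → row p < row q → entry p < entry q

QRWordOfShape : ℕ → List ℕ → Word → Set
QRWordOfShape n α w =
  InAlph n w × Σ Tableau (λ T → IsQuasiRibbonTableau T × shape T ≡ α × columnReading T ≡ w)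

standardRows : ℕ → List ℕ → Tableau
standardRows j [] = []
standardRows j (a ∷ as) = replicate a j ∷ standardRows (suc j) as

highestTableau : List ℕ → Tableau
highestTableau α = standardRows 1 α

data HasInv (i : ℕ) : Word → Set where
  here  : ∀ {xs} → i ∈ xs → HasInv i (suc i ∷ xs)
  there : ∀ {x xs} → HasInv i xs → HasInv i (x ∷ xs)

replaceFirst : ℕ → ℕ → Word → Maybe Word
replaceFirst a b [] = nothing
replaceFirst a b (x ∷ xs) with does (x ≟ a)
... | Data.Bool.true = just (b ∷ xs)
... | Data.Bool.false with replaceFirst a b xs
...   | just ys = just (x ∷ ys)
...   | nothing = nothing

replaceLast : ℕ → ℕ → Word → Maybe Word
replaceLast a b [] = nothing
replaceLast a b (x ∷ xs) with replaceLast a b xs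
... | just ys = just (x ∷ ys)
... | nothing = if does (x ≟ a) then just (b ∷ xs) else nothing

E : ℕ → Word → Word → Set
E i u v = ¬ HasInv i u × replaceFirst (suc i) i u ≡ just v

F : ℕ → Word → Word → Set
F i u v = ¬ HasInv i u × replaceLast i (suc i) u ≡ just v

Edge : ℕ → Word → Word → Set
Edge n u v = InAlph n u × Σ ℕ (λ i → 1 ≤ i × i < n × F i u v)

Connected : ℕ → Word → Word → Set
Connected n = Star (SymClosure (Edge n))

HighestWeight : ℕ → Word → Set
HighestWeight n w = ∀ i → 1 ≤ i → i < n → ∀ v → ¬ E i w v

-- Encode a quasi-ribbon tableau by its filling read in row-major order, each box flagged
-- when it ends its row. In this order the entries weakly increase and the column reading
-- only reverses the columns, so the reading has an i-inversion exactly when some i lies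
-- directly above an i + 1. Hence f_i (resp. e_i), when defined on the reading of a
-- tableau, raises its last i (resp. lowers its first i + 1) and gives the reading of a
-- tableau of the same shape: the quasi-ribbon words of shape α form a union of
-- components. Lowering decreases the sum of the entries, so every such word descends by
-- e-moves to one on which no e_i is defined. There every i + 1 > 1 sits directly below an
-- i, which forces row h to consist of h's: this highest-weight tableau is reached from
-- every word of shape α, so the component is connected and its highest weight unique.

module Submission where

open import Defs
open import Data.Bool using (Bool; true; false; not)
open import Data.Nat using (ℕ; zero; suc; _+_; _∸_; _≤_; _<_; _≟_; z≤n; s≤s; z<s)
open import Data.Nat.Properties
open import Data.Nat.ListAction using (sum)
open import Data.Nat.Induction using (<-wellFounded)
open import Data.List
  using (List; []; _∷_; _++_; [_]; _∷ʳ_; length; map; filter; reverse; replicate; concatMap; applyUpTo; zipWith)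
open import Data.List.Properties
  using ( ++-assoc; ++-identityʳ; reverse-++; map-++; length-replicate; ∷ʳ-++; ∷-injectiveʳ
        ; filter-++; filter-all; filter-none)
open import Data.List.Membership.Propositional using (_∈_; _∉_)
open import Data.List.Membership.Propositional.Properties using (∈-++⁺ˡ; ∈-++⁺ʳ; ∈-++⁻; ∈-map⁺)
open import Data.List.Membership.DecPropositional _≟_ using (_∈?_)
open import Data.List.Relation.Unary.All as All using (All; []; _∷_)
import Data.List.Relation.Unary.All.Properties as All
open import Data.List.Relation.Unary.All.Properties using (All¬⇒¬Any; ¬Any⇒All¬)
open import Data.List.Relation.Unary.Any using (Any; here; there; any?)
import Data.List.Relation.Unary.Any.Properties as Any
open import Data.List.Relation.Unary.AllPairs using (AllPairs; _∷_)
open import Data.List.Relation.Unary.Linked using (Linked; []; [-]; _∷_; head; tail)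
open import Data.List.Relation.Unary.Linked.Properties using (Linked⇒All; Linked⇒AllPairs)
open import Data.List.Relation.Binary.Permutation.Propositional
  using (_↭_; ↭-sym; ↭-trans; ↭-reflexive; module PermutationReasoning)
open import Data.List.Relation.Binary.Permutation.Propositional.Properties using (shift; ++⁺ˡ; ∈-resp-↭; All-resp-↭)
open import Data.Maybe using (just; nothing)
open import Data.Maybe.Properties using (just-injective)
open import Data.Product using (Σ; ∃; ∃₂; _×_; _,_; proj₁; proj₂)
open import Data.Sum using (_⊎_; inj₁; inj₂)
open import Function using (_∘_; id)
open import Function.Bundles using (_⇔_; mk⇔)
open import Induction.WellFounded using (Acc; acc)
open import Relation.Binary using (Transitive)
open import Relation.Binary.PropositionalEquality hiding ([_])
open import Relation.Binary.Construct.Closure.ReflexiveTransitive using (ε; _◅_; _◅◅_) renaming (reverse to Star-reverse)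
open import Relation.Binary.Construct.Closure.Symmetric using (fwd; bwd; symmetric)
open import Relation.Nullary using (¬_; Dec; yes; no; contradiction)
open import Relation.Nullary.Decidable using (dec-true; dec-false; decidable-stable)
open import Relation.Unary using (Decidable; ∁)

module _ {X : Set} {P : X → Set} (P? : Decidable P) where

  firstSplit : ∀ {xs} → Any P xs → ∃₂ λ ys zs → ∃ λ x → xs ≡ ys ++ x ∷ zs × P x × All (∁ P) ys
  firstSplit {x ∷ xs} p with P? x | p
  ... | yes px | _ = [] , xs , x , refl , px , []
  ... | no ¬px | here px = contradiction px ¬px
  ... | no ¬px | there q with firstSplit q
  ...   | ys , zs , y , refl , py , ¬ys = x ∷ ys , zs , y , refl , py , ¬px ∷ ¬ys

  lastSplit : ∀ {xs} → Any P xs → ∃₂ λ ys zs → ∃ λ x → xs ≡ ys ++ x ∷ zs × P x × All (∁ P) zs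
  lastSplit {x ∷ xs} p with any? P? xs | p
  ... | yes q | _ with lastSplit q
  ...   | ys , zs , y , refl , py , ¬zs = x ∷ ys , zs , y , refl , py , ¬zs
  lastSplit {x ∷ xs} p | no ¬q | here px = [] , xs , x , refl , px , ¬Any⇒All¬ xs ¬q
  lastSplit {x ∷ xs} p | no ¬q | there q = contradiction q ¬q

All-<⇒∉ : ∀ {a xs} → All (_< a) xs → a ∉ xs
All-<⇒∉ = All¬⇒¬Any ∘ All.map (λ x<a a≡x → <-irrefl (sym a≡x) x<a)

All->⇒∉ : ∀ {a xs} → All (a <_) xs → a ∉ xs
All->⇒∉ = All¬⇒¬Any ∘ All.map (λ a<x a≡x → <-irrefl a≡x a<x)

AllPairs-∈ : ∀ {A : Set} {R : A → A → Set} {xs x y} → AllPairs R xs → x ∈ xs → y ∈ xs →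
  x ≡ y ⊎ R x y ⊎ R y x
AllPairs-∈ (_ ∷ _) (here refl) (here refl) = inj₁ refl
AllPairs-∈ (Rz ∷ _) (here refl) (there y∈) = inj₂ (inj₁ (All.lookup Rz y∈))
AllPairs-∈ (Rz ∷ _) (there x∈) (here refl) = inj₂ (inj₂ (All.lookup Rz x∈))
AllPairs-∈ (_ ∷ Rs) (there x∈) (there y∈) = AllPairs-∈ Rs x∈ y∈

replaceLast-∉ : ∀ {a} b w → a ∉ w → replaceLast a b w ≡ nothing
replaceLast-∉ b [] _ = refl
replaceLast-∉ {a} b (x ∷ w) a∉
  rewrite replaceLast-∉ b w (a∉ ∘ there) | dec-false (x ≟ a) (a∉ ∘ here ∘ sym) = refl

replaceLast-last : ∀ a b A {B} → a ∉ B → replaceLast a b (A ++ a ∷ B) ≡ just (A ++ b ∷ B)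
replaceLast-last a b [] {B} a∉B rewrite replaceLast-∉ b B a∉B | dec-true (a ≟ a) refl = refl
replaceLast-last a b (x ∷ A) a∉B rewrite replaceLast-last a b A a∉B = refl

replaceLast-just⁻ : ∀ {a b} w {u} → replaceLast a b w ≡ just u →
  ∃₂ λ A B → w ≡ A ++ a ∷ B × a ∉ B × u ≡ A ++ b ∷ B
replaceLast-just⁻ {a} {b} w eq with a ∈? w
... | no a∉w = contradiction (trans (sym (replaceLast-∉ b w a∉w)) eq) λ ()
... | yes a∈w with lastSplit (a ≟_) a∈w
...   | A , B , _ , refl , refl , a∉B =
  A , B , refl , All¬⇒¬Any a∉B , just-injective (trans (sym eq) (replaceLast-last a b A (All¬⇒¬Any a∉B)))

replaceFirst-∉ : ∀ {a} b w → a ∉ w → replaceFirst a b w ≡ nothing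
replaceFirst-∉ b [] _ = refl
replaceFirst-∉ {a} b (x ∷ w) a∉
  rewrite dec-false (x ≟ a) (a∉ ∘ here ∘ sym) | replaceFirst-∉ b w (a∉ ∘ there) = refl

replaceFirst-first : ∀ a b A {B} → a ∉ A → replaceFirst a b (A ++ a ∷ B) ≡ just (A ++ b ∷ B)
replaceFirst-first a b [] _ rewrite dec-true (a ≟ a) refl = refl
replaceFirst-first a b (x ∷ A) {B} a∉ rewrite dec-false (x ≟ a) (a∉ ∘ here ∘ sym)
  with replaceFirst a b (A ++ a ∷ B) | replaceFirst-first a b A {B} (a∉ ∘ there)
... | _ | refl = refl

replaceFirst-just⇒∈ : ∀ {a b} w {u} → replaceFirst a b w ≡ just u → a ∈ w
replaceFirst-just⇒∈ {a} {b} w eq with a ∈? w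
... | yes a∈w = a∈w
... | no a∉w = contradiction (trans (sym (replaceFirst-∉ b w a∉w)) eq) λ ()

HasInv⇒suc∈ : ∀ {i w} → HasInv i w → suc i ∈ w
HasInv⇒suc∈ (here _) = here refl
HasInv⇒suc∈ (there h) = there (HasInv⇒suc∈ h)

HasInv⇒∈ : ∀ {i w} → HasInv i w → i ∈ w
HasInv⇒∈ (here i∈w) = there i∈w
HasInv⇒∈ (there h) = there (HasInv⇒∈ h)

HasInv-++ : ∀ {i} A {B} → suc i ∈ A → i ∈ B → HasInv i (A ++ B)
HasInv-++ (_ ∷ A) (here refl) i∈B = here (∈-++⁺ʳ A i∈B)
HasInv-++ (_ ∷ A) (there m) i∈B = there (HasInv-++ A m i∈B)

HasInv-after : ∀ {i} A {B} → suc i ∉ A → HasInv i (A ++ suc i ∷ B) → i ∈ B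
HasInv-after [] _ (here i∈B) = i∈B
HasInv-after [] _ (there h) = HasInv⇒∈ h
HasInv-after (_ ∷ A) ∉A (here _) = contradiction (here refl) ∉A
HasInv-after (_ ∷ A) ∉A (there h) = HasInv-after A (∉A ∘ there) h

F⇒E : ∀ {i u v} → F i u v → E i v u
F⇒E {i} {u} (¬inv , eq) with replaceLast-just⁻ u eq
... | A , B , refl , i∉B , refl = ¬inv′ , replaceFirst-first (suc i) i A suc∉A
  where
  suc∉A : suc i ∉ A
  suc∉A m = ¬inv (HasInv-++ A m (here refl))
  ¬inv′ : ¬ HasInv i (A ++ suc i ∷ B)
  ¬inv′ = i∉B ∘ HasInv-after A suc∉A

-- Quasi-ribbon fillings and their column reading

-- A filling of a ribbon diagram, listed box by box in row-major order; the flag of a box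
-- is true when it ends its row, so that the next box lies directly below it.
Ribbon : Set
Ribbon = List (ℕ × Bool)

entries : Ribbon → List ℕ
entries = map proj₁

flags : Ribbon → List Bool
flags = map proj₂

_↝_ : ℕ × Bool → ℕ × Bool → Set
(v , true) ↝ (u , _) = v < u
(v , false) ↝ (u , _) = v ≤ u

QuasiRibbon : Ribbon → Set
QuasiRibbon = Linked _↝_

↝⇒≤ : ∀ {x y} → x ↝ y → proj₁ x ≤ proj₁ y
↝⇒≤ {_ , true} = <⇒≤
↝⇒≤ {_ , false} = id

↝-trans : Transitive _↝_
↝-trans {_ , true} x↝y y↝z = <-≤-trans x↝y (↝⇒≤ y↝z)
↝-trans {_ , false} x↝y y↝z = ≤-trans x↝y (↝⇒≤ y↝z)

QuasiRibbon-∷⇒All : ∀ {x s} → QuasiRibbon (x ∷ s) → All (x ↝_) s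
QuasiRibbon-∷⇒All [-] = []
QuasiRibbon-∷⇒All (x↝y ∷ q) = Linked⇒All ↝-trans x↝y q

QuasiRibbon-∷⇒≤ : ∀ {v b s} → QuasiRibbon ((v , b) ∷ s) → All (v ≤_) (entries s)
QuasiRibbon-∷⇒≤ = All.map⁺ ∘ All.map ↝⇒≤ ∘ QuasiRibbon-∷⇒All

QuasiRibbon-∷⇒< : ∀ {v s} → QuasiRibbon ((v , true) ∷ s) → All (v <_) (entries s)
QuasiRibbon-∷⇒< = All.map⁺ ∘ QuasiRibbon-∷⇒All

QuasiRibbon-++⁻ʳ : ∀ P {s} → QuasiRibbon (P ++ s) → QuasiRibbon s
QuasiRibbon-++⁻ʳ [] q = q
QuasiRibbon-++⁻ʳ (_ ∷ P) q = QuasiRibbon-++⁻ʳ P (tail q)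

-- col holds the boxes of the current column already passed, bottom box first.
readingFrom : List ℕ → Ribbon → Word
readingFrom col [] = col
readingFrom col ((v , true) ∷ s) = readingFrom (v ∷ col) s
readingFrom col ((v , false) ∷ s) = v ∷ col ++ readingFrom [] s

reading : Ribbon → Word
reading = readingFrom []

columnTail : Ribbon → Word
columnTail [] = []
columnTail ((v , true) ∷ s) = columnTail s ++ [ v ]
columnTail ((v , false) ∷ s) = [ v ]

afterColumn : Ribbon → Word
afterColumn [] = []
afterColumn ((v , true) ∷ s) = afterColumn s
afterColumn ((v , false) ∷ s) = reading s

readingFrom-split : ∀ col s → readingFrom col s ≡ columnTail s ++ col ++ afterColumn s
readingFrom-split col [] = sym (++-identityʳ col)
readingFrom-split col ((v , true) ∷ s) =
  trans (readingFrom-split (v ∷ col) s) (sym (++-assoc (columnTail s) [ v ] _))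
readingFrom-split col ((v , false) ∷ s) = refl

below : Bool → Ribbon → Word
below true = columnTail
below false _ = []

beyond : Bool → Ribbon → Word
beyond true = afterColumn
beyond false = reading

readingFrom-∷ : ∀ col v b s → readingFrom col ((v , b) ∷ s) ≡ below b s ++ v ∷ col ++ beyond b s
readingFrom-∷ col v true s = readingFrom-split (v ∷ col) s
readingFrom-∷ col v false s = refl

-- For a prefix P, emitted is the reading of the columns P completes and pending the part
-- of the column left open, bottom box first.
emitted : List ℕ → Ribbon → Word
emitted col [] = []
emitted col ((v , true) ∷ P) = emitted (v ∷ col) P
emitted col ((v , false) ∷ P) = v ∷ col ++ emitted [] P

pending : List ℕ → Ribbon → List ℕ
pending col [] = col
pending col ((v , true) ∷ P) = pending (v ∷ col) P
pending col ((v , false) ∷ P) = pending [] P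

readingFrom-++ : ∀ col P R → readingFrom col (P ++ R) ≡ emitted col P ++ readingFrom (pending col P) R
readingFrom-++ col [] R = refl
readingFrom-++ col ((v , true) ∷ P) R = readingFrom-++ (v ∷ col) P R
readingFrom-++ col ((v , false) ∷ P) R =
  cong (v ∷_) (trans (cong (col ++_) (readingFrom-++ [] P R)) (sym (++-assoc col (emitted [] P) _)))

before : Ribbon → Bool → Ribbon → Word
before P b R = emitted [] P ++ below b R

after : Ribbon → Bool → Ribbon → Word
after P b R = pending [] P ++ beyond b R

-- The reading passes the box (v , b) between two words that do not depend on v.
reading-focus : ∀ P v b R → reading (P ++ (v , b) ∷ R) ≡ before P b R ++ v ∷ after P b R
reading-focus P v b R = begin
  reading (P ++ (v , b) ∷ R)                                 ≡⟨ readingFrom-++ [] P _ ⟩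
  emitted [] P ++ readingFrom (pending [] P) ((v , b) ∷ R)   ≡⟨ cong (emitted [] P ++_) (readingFrom-∷ _ v b R) ⟩
  emitted [] P ++ below b R ++ v ∷ after P b R               ≡⟨ sym (++-assoc (emitted [] P) _ _) ⟩
  before P b R ++ v ∷ after P b R                            ∎
  where open ≡-Reasoning

readingFrom-↭ : ∀ col s → readingFrom col s ↭ col ++ entries s
readingFrom-↭ col [] = ↭-reflexive (sym (++-identityʳ col))
readingFrom-↭ col ((v , true) ∷ s) = ↭-trans (readingFrom-↭ (v ∷ col) s) (↭-sym (shift v col (entries s)))
readingFrom-↭ col ((v , false) ∷ s) =
  ↭-trans (++⁺ˡ (v ∷ col) (readingFrom-↭ [] s)) (↭-sym (shift v col (entries s)))

reading-↭ : ∀ s → reading s ↭ entries s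
reading-↭ = readingFrom-↭ []

emitted-pending-↭ : ∀ P → emitted [] P ++ pending [] P ↭ entries P
emitted-pending-↭ P = begin
  emitted [] P ++ pending [] P  ≡⟨ sym (readingFrom-++ [] P []) ⟩
  reading (P ++ [])             ≡⟨ cong reading (++-identityʳ P) ⟩
  reading P                     ↭⟨ reading-↭ P ⟩
  entries P                     ∎
  where open PermutationReasoning

below-beyond-↭ : ∀ b R → below b R ++ beyond b R ↭ entries R
below-beyond-↭ true R = ↭-trans (↭-reflexive (sym (readingFrom-split [] R))) (reading-↭ R)
below-beyond-↭ false R = reading-↭ R

∈-reading : ∀ {x} s → x ∈ reading s → x ∈ entries s
∈-reading s = ∈-resp-↭ (reading-↭ s)

All-reading⁺ : ∀ {Q : ℕ → Set} s → All Q (entries s) → All Q (reading s)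
All-reading⁺ s = All-resp-↭ (↭-sym (reading-↭ s))

All-reading⁻ : ∀ {Q : ℕ → Set} s → All Q (reading s) → All Q (entries s)
All-reading⁻ s = All-resp-↭ (reading-↭ s)

∈-emitted : ∀ {x} P → x ∈ emitted [] P → x ∈ entries P
∈-emitted P = ∈-resp-↭ (emitted-pending-↭ P) ∘ ∈-++⁺ˡ

∈-below : ∀ {x} b R → x ∈ below b R → x ∈ entries R
∈-below b R = ∈-resp-↭ (below-beyond-↭ b R) ∘ ∈-++⁺ˡ

∈-beyond : ∀ {x} b R → x ∈ beyond b R → x ∈ entries R
∈-beyond b R = ∈-resp-↭ (below-beyond-↭ b R) ∘ ∈-++⁺ʳ (below b R)

firstCell : ∀ a s → a ∈ entries s → ∃₂ λ P R → ∃ λ b → s ≡ P ++ (a , b) ∷ R × a ∉ entries P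
firstCell a s a∈ with firstSplit (λ x → a ≟ proj₁ x) (Any.map⁻ a∈)
... | P , R , (_ , b) , refl , refl , a∉P = P , R , b , refl , All¬⇒¬Any (All.map⁺ a∉P)

lastCell : ∀ a s → a ∈ entries s → ∃₂ λ P R → ∃ λ b → s ≡ P ++ (a , b) ∷ R × a ∉ entries R
lastCell a s a∈ with lastSplit (λ x → a ≟ proj₁ x) (Any.map⁻ a∈)
... | P , R , (_ , b) , refl , refl , a∉R = P , R , b , refl , All¬⇒¬Any (All.map⁺ a∉R)

firstEntry : Ribbon → ℕ → ℕ
firstEntry [] u = u
firstEntry ((v , _) ∷ _) _ = v

firstEntry-> : ∀ P {p u b R} → QuasiRibbon ((p , true) ∷ P ++ (u , b) ∷ R) → p < firstEntry P u
firstEntry-> [] q = head q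
firstEntry-> (_ ∷ _) q = head q

pending-< : ∀ P {col u b R} → QuasiRibbon (P ++ (u , b) ∷ R) →
  All (_< firstEntry P u) col → All (_< u) (pending col P)
pending-< [] q col< = col<
pending-< ((p , true) ∷ P) q col< =
  pending-< P (tail q) (p<next ∷ All.map (λ x<p → <-trans x<p p<next) col<)
  where p<next = firstEntry-> P q
pending-< ((p , false) ∷ P) q col< = pending-< P (tail q) []

-- Inversions of the reading

-- Some i lies directly above an i + 1.
data Stacked (i : ℕ) : Ribbon → Set where
  here : ∀ {c s} → Stacked i ((i , true) ∷ (suc i , c) ∷ s)
  there : ∀ {x s} → Stacked i s → Stacked i (x ∷ s)

stacked? : ∀ i s → Dec (Stacked i s)
stacked? i [] = no λ ()
stacked? i (x ∷ []) = no λ { (there ()) }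
stacked? i ((v , b) ∷ (u , c) ∷ s) with stacked? i ((u , c) ∷ s)
... | yes st = yes (there st)
... | no ¬st with v ≟ i | b | u ≟ suc i
...   | yes refl | true | yes refl = yes here
...   | no v≢i | _ | _ = no λ { here → v≢i refl ; (there st) → ¬st st }
...   | yes _ | false | _ = no λ { (there st) → ¬st st }
...   | yes _ | true | no u≢1+i = no λ { here → u≢1+i refl ; (there st) → ¬st st }

Stacked⇒∈ : ∀ {i s} → Stacked i s → i ∈ entries s
Stacked⇒∈ here = here refl
Stacked⇒∈ (there st) = there (Stacked⇒∈ st)

Stacked⇒head≤ : ∀ {i v b s} → QuasiRibbon ((v , b) ∷ s) → Stacked i ((v , b) ∷ s) → v ≤ i
Stacked⇒head≤ q st with Stacked⇒∈ st
... | here refl = ≤-refl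
... | there i∈s = All.lookup (QuasiRibbon-∷⇒≤ q) i∈s

Stacked-split : ∀ {i s} → Stacked i s → ∃₂ λ P R → ∃ λ c → s ≡ P ++ (i , true) ∷ (suc i , c) ∷ R
Stacked-split (here {c} {s}) = [] , s , c , refl
Stacked-split {s = x ∷ _} (there st) with Stacked-split st
... | P , R , c , refl = x ∷ P , R , c , refl

∈-columnTail : ∀ v c R → v ∈ columnTail ((v , c) ∷ R)
∈-columnTail v true R = ∈-++⁺ʳ (columnTail R) (here refl)
∈-columnTail v false R = here refl

Stacked⇒HasInv : ∀ {i} s → Stacked i s → HasInv i (reading s)
Stacked⇒HasInv {i} s st with Stacked-split st
... | P , R , c , refl rewrite reading-focus P i true ((suc i , c) ∷ R) =
  HasInv-++ (before P true ((suc i , c) ∷ R)) (∈-++⁺ʳ (emitted [] P) (∈-columnTail (suc i) c R)) (here refl)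

pending-stacked : ∀ P {col i b R} → QuasiRibbon (P ++ (suc i , b) ∷ R) →
  All (_< firstEntry P (suc i)) col → i ∈ pending col P →
  (P ≡ [] × i ∈ col) ⊎ Stacked i (P ++ (suc i , b) ∷ R)
pending-stacked [] q col< i∈ = inj₁ (refl , i∈)
pending-stacked ((p , true) ∷ P) q col< i∈
  with pending-stacked P (tail q) (p<next ∷ All.map (λ x<p → <-trans x<p p<next) col<) i∈
  where p<next = firstEntry-> P q
... | inj₁ (refl , here refl) = inj₂ here
... | inj₁ (refl , there i∈col) = contradiction (≤-trans (All.lookup col< i∈col) (≤-pred (head q))) (<-irrefl refl)
... | inj₂ st = inj₂ (there st)
pending-stacked ((p , false) ∷ P) q col< i∈ with pending-stacked P (tail q) [] i∈
... | inj₂ st = inj₂ (there st)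

∉-below : ∀ b {v R} → QuasiRibbon ((v , b) ∷ R) → v ∉ below b R
∉-below true q = All->⇒∉ (QuasiRibbon-∷⇒< q) ∘ ∈-below true _
∉-below false _ ()

∉-before : ∀ P {v b R} → QuasiRibbon (P ++ (v , b) ∷ R) → v ∉ entries P → v ∉ before P b R
∉-before P {b = b} q v∉P m with ∈-++⁻ (emitted [] P) m
... | inj₁ m′ = v∉P (∈-emitted P m′)
... | inj₂ m′ = ∉-below b (QuasiRibbon-++⁻ʳ P q) m′

∉-after : ∀ P {v b R} → QuasiRibbon (P ++ (v , b) ∷ R) → v ∉ entries R → v ∉ after P b R
∉-after P {b = b} q v∉R m with ∈-++⁻ (pending [] P) m
... | inj₁ m′ = All-<⇒∉ (pending-< P q []) m′
... | inj₂ m′ = v∉R (∈-beyond b _ m′)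

-- Reading along s, an inversion i + 1 … i can only occur inside one column.
¬Stacked⇒¬HasInv : ∀ {i} s → QuasiRibbon s → ¬ Stacked i s → ¬ HasInv i (reading s)
¬Stacked⇒¬HasInv {i} s q ¬st inv with firstCell (suc i) s (∈-reading s (HasInv⇒suc∈ inv))
... | P , R , b , refl , suc∉P with ∈-++⁻ (pending [] P) (HasInv-after (before P b R) (∉-before P q suc∉P) inv′)
  where inv′ = subst (HasInv i) (reading-focus P (suc i) b R) inv
... | inj₁ i∈pending with pending-stacked P q [] i∈pending
...   | inj₂ st = ¬st st
¬Stacked⇒¬HasInv s q ¬st inv | P , R , b , refl , _ | inj₂ i∈beyond =
  All->⇒∉ (QuasiRibbon-∷⇒≤ (QuasiRibbon-++⁻ʳ P q)) (∈-beyond b R i∈beyond)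

-- Raising and lowering an entry

reading-raise : ∀ P {i b R} → QuasiRibbon (P ++ (i , b) ∷ R) → i ∉ entries R →
  replaceLast i (suc i) (reading (P ++ (i , b) ∷ R)) ≡ just (reading (P ++ (suc i , b) ∷ R))
reading-raise P {i} {b} {R} q i∉R rewrite reading-focus P i b R | reading-focus P (suc i) b R =
  replaceLast-last i (suc i) (before P b R) (∉-after P q i∉R)

↝-lowerˡ : ∀ {v b y} → (suc v , b) ↝ y → (v , b) ↝ y
↝-lowerˡ {b = true} = <-trans (n<1+n _)
↝-lowerˡ {b = false} = ≤-trans (n≤1+n _)

↝-raiseʳ : ∀ {x v b} → x ↝ (v , b) → x ↝ (suc v , b)
↝-raiseʳ {_ , true} = m<n⇒m<1+n
↝-raiseʳ {_ , false} = m≤n⇒m≤1+n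

raise-quasiRibbon : ∀ P {i b R} → QuasiRibbon (P ++ (i , b) ∷ R) → i ∉ entries R →
  ¬ Stacked i (P ++ (i , b) ∷ R) → QuasiRibbon (P ++ (suc i , b) ∷ R)
raise-quasiRibbon [] {R = []} _ _ _ = [-]
raise-quasiRibbon [] {b = true} {R = (u , c) ∷ R} (i<u ∷ q) i∉R ¬st =
  ≤∧≢⇒< i<u (λ { refl → ¬st here }) ∷ q
raise-quasiRibbon [] {b = false} {R = (u , c) ∷ R} (i≤u ∷ q) i∉R ¬st =
  ≤∧≢⇒< i≤u (λ i≡u → i∉R (here i≡u)) ∷ q
raise-quasiRibbon (x ∷ []) (x↝ ∷ q) i∉R ¬st = ↝-raiseʳ x↝ ∷ raise-quasiRibbon [] q i∉R (¬st ∘ there)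
raise-quasiRibbon (x ∷ y ∷ P) (x↝y ∷ q) i∉R ¬st = x↝y ∷ raise-quasiRibbon (y ∷ P) q i∉R (¬st ∘ there)

lower-quasiRibbon : ∀ P {i b R} → QuasiRibbon (P ++ (suc i , b) ∷ R) → suc i ∉ entries P →
  ¬ Stacked i (P ++ (suc i , b) ∷ R) → QuasiRibbon (P ++ (i , b) ∷ R)
lower-quasiRibbon [] [-] _ _ = [-]
lower-quasiRibbon [] (↝y ∷ q) _ _ = ↝-lowerˡ ↝y ∷ q
lower-quasiRibbon ((p , true) ∷ []) (p<1+i ∷ q) _ ¬st =
  ≤∧≢⇒< (≤-pred p<1+i) (λ { refl → ¬st here }) ∷ lower-quasiRibbon [] q (λ ()) (¬st ∘ there)
lower-quasiRibbon ((p , false) ∷ []) (p≤1+i ∷ q) suc∉P ¬st =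
  ≤-pred (≤∧≢⇒< p≤1+i (λ p≡1+i → suc∉P (here (sym p≡1+i))))
  ∷ lower-quasiRibbon [] q (λ ()) (¬st ∘ there)
lower-quasiRibbon (x ∷ y ∷ P) (x↝y ∷ q) suc∉P ¬st =
  x↝y ∷ lower-quasiRibbon (y ∷ P) q (suc∉P ∘ there) (¬st ∘ there)

lower-¬Stacked : ∀ P {i b R} → QuasiRibbon (P ++ (suc i , b) ∷ R) → suc i ∉ entries P →
  ¬ Stacked i (P ++ (suc i , b) ∷ R) → ¬ Stacked i (P ++ (i , b) ∷ R)
lower-¬Stacked [] (1+i<1+i ∷ _) _ _ here = <-irrefl refl 1+i<1+i
lower-¬Stacked [] _ _ ¬st (there st) = ¬st (there st)
lower-¬Stacked (_ ∷ []) q _ ¬st (there st) = lower-¬Stacked [] (tail q) (λ ()) (¬st ∘ there) st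
lower-¬Stacked (_ ∷ (p , _) ∷ P) _ suc∉P _ here = suc∉P (there (here refl))
lower-¬Stacked (_ ∷ y ∷ P) q suc∉P ¬st (there st) =
  lower-¬Stacked (y ∷ P) (tail q) (suc∉P ∘ there) (¬st ∘ there) st

next : Bool → ℕ → ℕ
next true = suc
next false v = v

next-≥ : ∀ b j → j ≤ next b j
next-≥ true j = n≤1+n j
next-≥ false j = ≤-refl

↝⇒next≤ : ∀ {v b y} → (v , b) ↝ y → next b v ≤ proj₁ y
↝⇒next≤ {b = true} v<u = v<u
↝⇒next≤ {b = false} v≤u = v≤u

-- Row h of the filling is constant, equal to j + h: the paper's highest-weight tableau.
highestFilling : ℕ → List Bool → Ribbon
highestFilling j [] = []
highestFilling j (b ∷ bs) = (j , b) ∷ highestFilling (next b j) bs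

highestFilling-quasiRibbon : ∀ j bs → QuasiRibbon (highestFilling j bs)
highestFilling-quasiRibbon j [] = []
highestFilling-quasiRibbon j (b ∷ []) = [-]
highestFilling-quasiRibbon j (true ∷ c ∷ bs) = ≤-refl ∷ highestFilling-quasiRibbon (suc j) (c ∷ bs)
highestFilling-quasiRibbon j (false ∷ c ∷ bs) = ≤-refl ∷ highestFilling-quasiRibbon j (c ∷ bs)

flags-highestFilling : ∀ j bs → flags (highestFilling j bs) ≡ bs
flags-highestFilling j [] = refl
flags-highestFilling j (b ∷ bs) = cong (b ∷_) (flags-highestFilling (next b j) bs)

highestFilling-stacked : ∀ {i j} bs → j ≤ i → suc i ∈ entries (highestFilling j bs) →
  Stacked i (highestFilling j bs)
highestFilling-stacked {i} (b ∷ bs) j≤i (here refl) = contradiction j≤i (<-irrefl refl)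
highestFilling-stacked (false ∷ bs) j≤i (there m) = there (highestFilling-stacked bs j≤i m)
highestFilling-stacked (true ∷ []) j≤i (there ())
highestFilling-stacked {i} {j} (true ∷ c ∷ bs) j≤i (there m) with j ≟ i
... | yes refl = here
... | no j≢i = there (highestFilling-stacked (c ∷ bs) (≤∧≢⇒< j≤i j≢i) m)

allStacked⇒highestFilling : ∀ {j} s → QuasiRibbon s → All (j ≤_) (entries s) →
  (∀ {i} → j ≤ i → suc i ∈ entries s → Stacked i s) → s ≡ highestFilling j (flags s)
allStacked⇒highestFilling [] _ _ _ = refl
allStacked⇒highestFilling {j} ((v , b) ∷ s) q (j≤v ∷ _) stacked with m≤n⇒m<n∨m≡n j≤v
allStacked⇒highestFilling ((suc i , b) ∷ s) q _ stacked | inj₁ (s≤s j≤i) =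
  contradiction (Stacked⇒head≤ q (stacked j≤i (here refl))) (<-irrefl refl)
... | inj₂ refl = cong ((j , b) ∷_) (allStacked⇒highestFilling s (tail q) next≤ stacked′)
  where
  next≤ : All (next b j ≤_) (entries s)
  next≤ = All.map⁺ (All.map ↝⇒next≤ (QuasiRibbon-∷⇒All q))
  stacked′ : ∀ {i} → next b j ≤ i → suc i ∈ entries s → Stacked i s
  stacked′ next≤i m with stacked (≤-trans (next-≥ b j) next≤i) (there m)
  ... | here = contradiction next≤i (<-irrefl refl)
  ... | there st = st

-- Components of the quasi-crystal graph

Letter : ℕ → ℕ → Set
Letter n a = 1 ≤ a × a ≤ n

record RibbonTableau (n : ℕ) (bs : List Bool) (s : Ribbon) : Set where
  field
    quasiRibbon : QuasiRibbon s
    flags≡ : flags s ≡ bs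
    letters : All (Letter n) (entries s)

open RibbonTableau

Represented : ℕ → List Bool → Word → Set
Represented n bs w = ∃ λ s → RibbonTableau n bs s × w ≡ reading s

flags-update : ∀ P {v v′ b R} → flags (P ++ (v , b) ∷ R) ≡ flags (P ++ (v′ , b) ∷ R)
flags-update [] = refl
flags-update (x ∷ P) = cong (proj₂ x ∷_) (flags-update P)

All-update : ∀ {Q : ℕ → Set} P {v v′ b R} → All Q (entries (P ++ (v , b) ∷ R)) → Q v′ →
  All Q (entries (P ++ (v′ , b) ∷ R))
All-update [] (_ ∷ qs) q = q ∷ qs
All-update (_ ∷ P) (q₀ ∷ qs) q = q₀ ∷ All-update P qs q

sum-lower : ∀ P {i b R} → sum (entries (P ++ (i , b) ∷ R)) < sum (entries (P ++ (suc i , b) ∷ R))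
sum-lower [] = ≤-refl
sum-lower ((p , _) ∷ P) = +-monoʳ-< p (sum-lower P)

lower : ∀ {n bs s i} → RibbonTableau n bs s → 1 ≤ i → suc i ∈ entries s → ¬ Stacked i s →
  ∃ λ s′ → RibbonTableau n bs s′ × F i (reading s′) (reading s) × sum (entries s′) < sum (entries s)
lower {s = s} {i} t 1≤i m ¬st with firstCell (suc i) s m
... | P , R , b , refl , suc∉P =
  P ++ (i , b) ∷ R , t′ , (¬Stacked⇒¬HasInv _ q′ ¬st′ , reading-raise P q′ i∉R) , sum-lower P
  where
  q′ = lower-quasiRibbon P (quasiRibbon t) suc∉P ¬st
  ¬st′ = lower-¬Stacked P (quasiRibbon t) suc∉P ¬st
  i∉R : i ∉ entries R
  i∉R = All->⇒∉ (QuasiRibbon-∷⇒≤ (QuasiRibbon-++⁻ʳ P (quasiRibbon t)))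
  t′ : RibbonTableau _ _ (P ++ (i , b) ∷ R)
  t′ = record
    { quasiRibbon = q′
    ; flags≡ = trans (flags-update P) (flags≡ t)
    ; letters = All-update P (letters t) (1≤i , ≤-trans (n≤1+n i) (proj₂ (All.lookup (letters t) m)))
    }

raise : ∀ {n bs s i v} → RibbonTableau n bs s → i < n → F i (reading s) v → Represented n bs v
raise {s = s} {i} t i<n (¬inv , eq) with replaceLast-just⁻ (reading s) eq
... | A , _ , read≡ , _ , _ with lastCell i s (∈-reading s (subst (i ∈_) (sym read≡) (∈-++⁺ʳ A (here refl))))
...   | P , R , b , refl , i∉R =
  P ++ (suc i , b) ∷ R , t′ , just-injective (trans (sym eq) (reading-raise P (quasiRibbon t) i∉R))
  where
  t′ : RibbonTableau _ _ (P ++ (suc i , b) ∷ R)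
  t′ = record
    { quasiRibbon = raise-quasiRibbon P (quasiRibbon t) i∉R (¬inv ∘ Stacked⇒HasInv _)
    ; flags≡ = trans (flags-update P) (flags≡ t)
    ; letters = All-update P (letters t) (s≤s z≤n , i<n)
    }

Represented-edge : ∀ {n bs u v} → Edge n u v → Represented n bs u → Represented n bs v
Represented-edge (_ , i , _ , i<n , f) (s , t , refl) = raise t i<n f

Represented-edge⁻ : ∀ {n bs u v} → Edge n u v → Represented n bs v → Represented n bs u
Represented-edge⁻ (_ , i , 1≤i , _ , f) (s , t , refl) with F⇒E f
... | ¬inv , eq with lower t 1≤i (∈-reading s (replaceFirst-just⇒∈ (reading s) eq)) (¬inv ∘ Stacked⇒HasInv s)
...   | s′ , t′ , f′ , _ = s′ , t′ , just-injective (trans (sym eq) (proj₂ (F⇒E f′)))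

Represented-closed : ∀ {n bs u v} → Connected n u v → Represented n bs u → Represented n bs v
Represented-closed ε r = r
Represented-closed (fwd e ◅ c) r = Represented-closed c (Represented-edge e r)
Represented-closed (bwd e ◅ c) r = Represented-closed c (Represented-edge⁻ e r)

stacked-or-lowerable : ∀ s xs → (∀ {i} → 1 ≤ i → suc i ∈ xs → Stacked i s) ⊎
                                 ∃ λ i → 1 ≤ i × suc i ∈ xs × ¬ Stacked i s
stacked-or-lowerable s [] = inj₁ λ _ ()
stacked-or-lowerable s (x ∷ xs) with stacked-or-lowerable s xs
... | inj₂ (i , 1≤i , m , ¬st) = inj₂ (i , 1≤i , there m , ¬st)
stacked-or-lowerable s (zero ∷ xs) | inj₁ stacked = inj₁ λ { _ (here ()) ; 1≤i (there m) → stacked 1≤i m }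
stacked-or-lowerable s (suc zero ∷ xs) | inj₁ stacked = inj₁ λ { () (here refl) ; 1≤i (there m) → stacked 1≤i m }
stacked-or-lowerable s (suc (suc k) ∷ xs) | inj₁ stacked with stacked? (suc k) s
... | yes st = inj₁ λ { _ (here refl) → st ; 1≤i (there m) → stacked 1≤i m }
... | no ¬st = inj₂ (suc k , s≤s z≤n , here refl , ¬st)

highestFilling-unique : ∀ {n bs s} → RibbonTableau n bs s →
  (∀ {i} → 1 ≤ i → suc i ∈ entries s → Stacked i s) → s ≡ highestFilling 1 bs
highestFilling-unique {s = s} t stacked = trans
  (allStacked⇒highestFilling s (quasiRibbon t) (All.map proj₁ (letters t)) stacked)
  (cong (highestFilling 1) (flags≡ t))

descend : ∀ {n bs s} → RibbonTableau n bs s → Acc _<_ (sum (entries s)) →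
  Connected n (reading s) (reading (highestFilling 1 bs))
descend {n} {s = s} t (acc smaller) with stacked-or-lowerable s (entries s)
... | inj₁ stacked = subst (Connected n (reading s) ∘ reading) (highestFilling-unique t stacked) ε
... | inj₂ (i , 1≤i , m , ¬st) with lower t 1≤i m ¬st
...   | s′ , t′ , f , decreasing =
  bwd (All-reading⁺ s′ (letters t′) , i , 1≤i , proj₂ (All.lookup (letters t) m) , f)
  ◅ descend t′ (smaller decreasing)

Represented-connected : ∀ {n bs u v} → Represented n bs u → Represented n bs v → Connected n u v
Represented-connected {n} (s , t , refl) (s′ , t′ , refl) =
  descend t (<-wellFounded _) ◅◅ Star-reverse (symmetric (Edge n)) (descend t′ (<-wellFounded _))

highestFilling-highestWeight : ∀ n bs → HighestWeight n (reading (highestFilling 1 bs))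
highestFilling-highestWeight n bs i 1≤i _ v (¬inv , eq) =
  ¬inv (Stacked⇒HasInv _ (highestFilling-stacked bs 1≤i (∈-reading _ (replaceFirst-just⇒∈ _ eq))))

highestWeight-unique : ∀ {n bs w} → Represented n bs w → HighestWeight n w → w ≡ reading (highestFilling 1 bs)
highestWeight-unique {n} (s , t , refl) hw = cong reading (highestFilling-unique t stacked)
  where
  stacked : ∀ {i} → 1 ≤ i → suc i ∈ entries s → Stacked i s
  stacked {i} 1≤i m = decidable-stable (stacked? i s) λ ¬st →
    let (s′ , _ , f , _) = lower t 1≤i m ¬st
    in hw i 1≤i (proj₂ (All.lookup (letters t) m)) (reading s′) (F⇒E f)

-- Quasi-ribbon tableaux as fillings

ribbonCells : ℕ → ℕ → Ribbon → List Cell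
ribbonCells c h [] = []
ribbonCells c h ((v , b) ∷ s) = (c , h , v) ∷ ribbonCells (next (not b) c) (next b h) s

prependRow : List ℕ → Ribbon → Ribbon
prependRow [] s = s
prependRow (x ∷ []) s = (x , true) ∷ s
prependRow (x ∷ y ∷ r) s = (x , false) ∷ prependRow (y ∷ r) s

toRibbon : Tableau → Ribbon
toRibbon [] = []
toRibbon (r ∷ T) = prependRow r (toRibbon T)

rowEnds : List ℕ → List Bool
rowEnds [] = []
rowEnds (a ∷ α) = replicate (a ∸ 1) false ++ true ∷ rowEnds α

rowCells : ℕ → ℕ → (ℕ → ℕ) → List ℕ → List Cell
rowCells c h g r = zipWith (λ j y → (c + j , h , y)) (applyUpTo g (length r)) r

-- Defs.cellsFrom places a row at columns c + 0, c + 1, …; reading the offsets through g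
-- lets the induction move the start of the row to column d.
rowCells-prependRow : ∀ c {d} h g x r s → (∀ j → c + g j ≡ d + j) →
  rowCells c h g (x ∷ r) ++ ribbonCells (d + length (x ∷ r) ∸ 1) (suc h) s ≡ ribbonCells d h (prependRow (x ∷ r) s)
rowCells-prependRow c {d} h g x [] s g≡ =
  cong₂ (λ d′ d″ → (d′ , h , x) ∷ ribbonCells d″ (suc h) s) (trans (g≡ 0) (+-identityʳ d)) (m+n∸n≡m d 1)
rowCells-prependRow c {d} h g x (y ∷ r) s g≡ =
  cong₂ (λ d′ cs → (d′ , h , x) ∷ cs) (trans (g≡ 0) (+-identityʳ d))
    (trans (cong (λ d″ → rowCells c h (g ∘ suc) (y ∷ r) ++ ribbonCells (d″ ∸ 1) (suc h) s)
                 (+-suc d (length (y ∷ r))))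
           (rowCells-prependRow c h (g ∘ suc) y r s λ j → trans (g≡ (suc j)) (+-suc d j)))

cells-toRibbon : ∀ c h T → IsComposition (shape T) → cellsFrom c h T ≡ ribbonCells c h (toRibbon T)
cells-toRibbon c h [] _ = refl
cells-toRibbon c h ((x ∷ r) ∷ T) (_ ∷ comp) =
  trans (cong (rowCells c h (λ j → j) (x ∷ r) ++_) (cells-toRibbon _ (suc h) T comp))
        (rowCells-prependRow c h (λ j → j) x r (toRibbon T) λ _ → refl)

columnOf : ℕ → List Cell → List ℕ
columnOf c L = map entry (filter (λ p → col p ≟ c) L)

readColumns : ℕ → ℕ → List Cell → Word
readColumns c zero L = []
readColumns c (suc N) L = reverse (columnOf c L) ++ readColumns (suc c) N L

concatMap-readColumns : ∀ L g c N → (∀ j → g j ≡ c + j) →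
  concatMap (λ k → reverse (columnOf k L)) (applyUpTo g N) ≡ readColumns c N L
concatMap-readColumns L g c zero g≡ = refl
concatMap-readColumns L g c (suc N) g≡ =
  cong₂ (λ k cols → reverse (columnOf k L) ++ cols) (trans (g≡ 0) (+-identityʳ c))
    (concatMap-readColumns L (g ∘ suc) (suc c) N λ j → trans (g≡ (suc j)) (+-suc c j))

columnOf-++ : ∀ {c} A {B} → All (λ p → col p ≡ c) A → All (λ p → col p ≢ c) B →
  columnOf c (A ++ B) ≡ map entry A
columnOf-++ {c} A {B} A≡ B≢ = cong (map entry) (begin
  filter (λ p → col p ≟ c) (A ++ B)                                 ≡⟨ filter-++ (λ p → col p ≟ c) A B ⟩
  filter (λ p → col p ≟ c) A ++ filter (λ p → col p ≟ c) B          ≡⟨ cong₂ _++_ (filter-all (λ p → col p ≟ c) A≡)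
                                                                                   (filter-none (λ p → col p ≟ c) B≢) ⟩
  A ++ []                                                           ≡⟨ ++-identityʳ A ⟩
  A                                                                 ∎)
  where open ≡-Reasoning

readColumns-skip : ∀ {c} N A {B} → All (λ p → col p < c) A → readColumns c N (A ++ B) ≡ readColumns c N B
readColumns-skip zero A _ = refl
readColumns-skip {c} (suc N) A {B} A< = cong₂ _++_
  (cong reverse (trans (cong (map entry) (filter-++ (λ p → col p ≟ c) A B))
                       (cong (λ cs → map entry (cs ++ _)) (filter-none (λ p → col p ≟ c) (All.map <⇒≢ A<)))))
  (readColumns-skip N A (All.map m<n⇒m<1+n A<))

readColumns-[] : ∀ c N → readColumns c N [] ≡ []
readColumns-[] c zero = refl
readColumns-[] c (suc N) = readColumns-[] (suc c) N

ribbonCells-col≥ : ∀ c h s → All (λ p → c ≤ col p) (ribbonCells c h s)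
ribbonCells-col≥ c h [] = []
ribbonCells-col≥ c h ((v , true) ∷ s) = ≤-refl ∷ ribbonCells-col≥ c (suc h) s
ribbonCells-col≥ c h ((v , false) ∷ s) = ≤-refl ∷ All.map (≤-trans (n≤1+n c)) (ribbonCells-col≥ (suc c) h s)

ribbonCells-col< : ∀ c h s → All (λ p → col p < c + length (ribbonCells c h s)) (ribbonCells c h s)
ribbonCells-col< c h [] = []
ribbonCells-col< c h ((v , true) ∷ s) =
  m<m+n c z<s ∷ All.map (λ lt → <-≤-trans lt (+-monoʳ-≤ c (n≤1+n _))) (ribbonCells-col< c (suc h) s)
ribbonCells-col< c h ((v , false) ∷ s) =
  m<m+n c z<s ∷ All.map (λ {p} → subst (col p <_) (sym (+-suc c (length (ribbonCells (suc c) h s)))))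
                        (ribbonCells-col< (suc c) h s)

reverse-map-∷ʳ : ∀ P (x : Cell) → reverse (map entry (P ∷ʳ x)) ≡ entry x ∷ reverse (map entry P)
reverse-map-∷ʳ P x = trans (cong reverse (map-++ entry P [ x ])) (reverse-++ (map entry P) [ entry x ])

≡⇒<suc : ∀ {c} {L : List Cell} → All (λ p → col p ≡ c) L → All (λ p → col p < suc c) L
≡⇒<suc = All.map (λ eq → ≤-reflexive (cong suc eq))

readColumns-close : ∀ N P {c B} → All (λ p → col p ≡ c) P → All (λ p → c < col p) B →
  readColumns c (suc N) (P ++ B) ≡ reverse (map entry P) ++ readColumns (suc c) N B
readColumns-close N P P≡ B> =
  cong₂ _++_ (cong reverse (columnOf-++ P P≡ (All.map >⇒≢ B>))) (readColumns-skip N P (≡⇒<suc P≡))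

-- P is the part of the current column already passed, in column c.
readColumns-ribbonCells : ∀ s {P c h N} → All (λ p → col p ≡ c) P →
  All (λ p → col p < c + N) (P ++ ribbonCells c h s) →
  readColumns c N (P ++ ribbonCells c h s) ≡ readingFrom (reverse (map entry P)) s
readColumns-ribbonCells [] {[]} {N = zero} _ _ = refl
readColumns-ribbonCells [] {_ ∷ _} {c} {N = zero} (p≡c ∷ _) (p< ∷ _) =
  contradiction p< (<-irrefl (trans p≡c (sym (+-identityʳ c))))
readColumns-ribbonCells [] {P} {c} {N = suc N} P≡ _ =
  trans (readColumns-close N P P≡ []) (trans (cong (reverse (map entry P) ++_) (readColumns-[] (suc c) N)) (++-identityʳ _))
readColumns-ribbonCells ((v , true) ∷ s) {P} {c} {h} {N} P≡ bound = begin
  readColumns c N (P ++ x ∷ rest)              ≡⟨ cong (readColumns c N) (sym (∷ʳ-++ P x rest)) ⟩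
  readColumns c N ((P ∷ʳ x) ++ rest)           ≡⟨ readColumns-ribbonCells s (All.++⁺ P≡ (refl ∷ []))
                                                     (subst (All _) (sym (∷ʳ-++ P x rest)) bound) ⟩
  readingFrom (reverse (map entry (P ∷ʳ x))) s  ≡⟨ cong (λ col → readingFrom col s) (reverse-map-∷ʳ P x) ⟩
  readingFrom (v ∷ reverse (map entry P)) s     ∎
  where
  open ≡-Reasoning
  x = (c , h , v)
  rest = ribbonCells c (suc h) s
readColumns-ribbonCells ((v , false) ∷ s) {P} {c} {h} {zero} P≡ bound =
  contradiction (All.lookup (All.++⁻ʳ P bound) (here refl)) (<-irrefl (sym (+-identityʳ c)))
readColumns-ribbonCells ((v , false) ∷ s) {P} {c} {h} {suc N} P≡ bound = begin
  readColumns c (suc N) (P ++ x ∷ rest)                         ≡⟨ cong (readColumns c (suc N)) (sym (∷ʳ-++ P x rest)) ⟩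
  readColumns c (suc N) ((P ∷ʳ x) ++ rest)                      ≡⟨ readColumns-close N (P ∷ʳ x) (All.++⁺ P≡ (refl ∷ []))
                                                                      (ribbonCells-col≥ (suc c) h s) ⟩
  reverse (map entry (P ∷ʳ x)) ++ readColumns (suc c) N rest    ≡⟨ cong₂ _++_ (reverse-map-∷ʳ P x) (readColumns-ribbonCells s [] rest<) ⟩
  v ∷ reverse (map entry P) ++ reading s                        ∎
  where
  open ≡-Reasoning
  x = (c , h , v)
  rest = ribbonCells (suc c) h s
  rest< : All (λ p → col p < suc c + N) rest
  rest< = All.map (λ {p} lt → subst (col p <_) (+-suc c N) lt) (All.++⁻ʳ (x ∷ []) (All.++⁻ʳ P bound))

columnReading-toRibbon : ∀ T → IsComposition (shape T) → columnReading T ≡ reading (toRibbon T)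
columnReading-toRibbon T comp rewrite cells-toRibbon 0 0 T comp =
  trans (concatMap-readColumns L (λ j → j) 0 (length L) λ _ → refl)
        (readColumns-ribbonCells (toRibbon T) [] (ribbonCells-col< 0 0 (toRibbon T)))
  where L = ribbonCells 0 0 (toRibbon T)

RowsWeak : List Cell → Set
RowsWeak L = ∀ {p q} → p ∈ L → q ∈ L → row p ≡ row q → col p < col q → entry p ≤ entry q

ColsStrict : List Cell → Set
ColsStrict L = ∀ {p q} → p ∈ L → q ∈ L → col p ≡ col q → row p < row q → entry p < entry q

ribbonCells⇒quasiRibbon : ∀ c h s → RowsWeak (ribbonCells c h s) → ColsStrict (ribbonCells c h s) → QuasiRibbon s
ribbonCells⇒quasiRibbon c h [] _ _ = []
ribbonCells⇒quasiRibbon c h (_ ∷ []) _ _ = [-]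
ribbonCells⇒quasiRibbon c h ((v , true) ∷ y ∷ s) rw cs =
  cs (here refl) (there (here refl)) refl (n<1+n h)
  ∷ ribbonCells⇒quasiRibbon c (suc h) (y ∷ s) (λ p q → rw (there p) (there q)) (λ p q → cs (there p) (there q))
ribbonCells⇒quasiRibbon c h ((v , false) ∷ y ∷ s) rw cs =
  rw (here refl) (there (here refl)) refl (n<1+n c)
  ∷ ribbonCells⇒quasiRibbon (suc c) h (y ∷ s) (λ p q → rw (there p) (there q)) (λ p q → cs (there p) (there q))

Precedes : Cell → Cell → Set
Precedes p q = (row p < row q × entry p < entry q) ⊎ (row p ≡ row q × col p < col q × entry p ≤ entry q)

Precedes-trans : Transitive Precedes
Precedes-trans (inj₁ (r₁ , e₁)) (inj₁ (r₂ , e₂)) = inj₁ (<-trans r₁ r₂ , <-trans e₁ e₂)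
Precedes-trans (inj₁ (r₁ , e₁)) (inj₂ (r₂ , _ , e₂)) = inj₁ (subst (_ <_) r₂ r₁ , <-≤-trans e₁ e₂)
Precedes-trans (inj₂ (r₁ , _ , e₁)) (inj₁ (r₂ , e₂)) = inj₁ (subst (_< _) (sym r₁) r₂ , ≤-<-trans e₁ e₂)
Precedes-trans (inj₂ (r₁ , c₁ , e₁)) (inj₂ (r₂ , c₂ , e₂)) =
  inj₂ (trans r₁ r₂ , <-trans c₁ c₂ , ≤-trans e₁ e₂)

quasiRibbon⇒linked : ∀ c h s → QuasiRibbon s → Linked Precedes (ribbonCells c h s)
quasiRibbon⇒linked c h [] _ = []
quasiRibbon⇒linked c h (_ ∷ []) _ = [-]
quasiRibbon⇒linked c h ((v , true) ∷ y ∷ s) (v<u ∷ q) =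
  inj₁ (n<1+n h , v<u) ∷ quasiRibbon⇒linked c (suc h) (y ∷ s) q
quasiRibbon⇒linked c h ((v , false) ∷ y ∷ s) (v≤u ∷ q) =
  inj₂ (refl , n<1+n c , v≤u) ∷ quasiRibbon⇒linked (suc c) h (y ∷ s) q

ribbonCells-related : ∀ c h s → QuasiRibbon s → ∀ {p q} → p ∈ ribbonCells c h s → q ∈ ribbonCells c h s →
  p ≡ q ⊎ Precedes p q ⊎ Precedes q p
ribbonCells-related c h s q = AllPairs-∈ (Linked⇒AllPairs Precedes-trans (quasiRibbon⇒linked c h s q))

quasiRibbon⇒rowsWeak : ∀ c h s → QuasiRibbon s → RowsWeak (ribbonCells c h s)
quasiRibbon⇒rowsWeak c h s q p∈ q∈ r≡ c< with ribbonCells-related c h s q p∈ q∈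
... | inj₁ refl = contradiction c< (<-irrefl refl)
... | inj₂ (inj₁ (inj₁ (r< , _))) = contradiction r< (<-irrefl r≡)
... | inj₂ (inj₁ (inj₂ (_ , _ , e≤))) = e≤
... | inj₂ (inj₂ (inj₁ (r< , _))) = contradiction r< (<-irrefl (sym r≡))
... | inj₂ (inj₂ (inj₂ (_ , c> , _))) = contradiction c> (<-asym c<)

quasiRibbon⇒colsStrict : ∀ c h s → QuasiRibbon s → ColsStrict (ribbonCells c h s)
quasiRibbon⇒colsStrict c h s q p∈ q∈ c≡ r< with ribbonCells-related c h s q p∈ q∈
... | inj₁ refl = contradiction r< (<-irrefl refl)
... | inj₂ (inj₁ (inj₁ (_ , e<))) = e<
... | inj₂ (inj₁ (inj₂ (r≡ , _ , _))) = contradiction r< (<-irrefl r≡)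
... | inj₂ (inj₂ (inj₁ (r> , _))) = contradiction r> (<-asym r<)
... | inj₂ (inj₂ (inj₂ (r≡ , _ , _))) = contradiction r< (<-irrefl (sym r≡))

entries-ribbonCells : ∀ c h s → map entry (ribbonCells c h s) ≡ entries s
entries-ribbonCells c h [] = refl
entries-ribbonCells c h ((v , b) ∷ s) = cong (v ∷_) (entries-ribbonCells _ _ s)

flags-prependRow : ∀ x r s → flags (prependRow (x ∷ r) s) ≡ replicate (length r) false ++ true ∷ flags s
flags-prependRow x [] s = refl
flags-prependRow x (y ∷ r) s = cong (false ∷_) (flags-prependRow y r s)

flags-toRibbon : ∀ T → IsComposition (shape T) → flags (toRibbon T) ≡ rowEnds (shape T)
flags-toRibbon [] _ = refl
flags-toRibbon ((x ∷ r) ∷ T) (_ ∷ comp) =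
  trans (flags-prependRow x r _) (cong (λ bs → replicate (length r) false ++ true ∷ bs) (flags-toRibbon T comp))

splitRow : ∀ k s {bs} → flags s ≡ replicate k false ++ true ∷ bs →
  ∃₂ λ x r → ∃ λ s′ → length r ≡ k × s ≡ prependRow (x ∷ r) s′ × flags s′ ≡ bs
splitRow zero ((v , true) ∷ s) eq = v , [] , s , refl , refl , ∷-injectiveʳ eq
splitRow (suc k) ((v , false) ∷ s) eq with splitRow k s (∷-injectiveʳ eq)
... | y , r , s′ , refl , refl , fl = v , y ∷ r , s′ , refl , refl , fl

fromRibbon : ∀ α s → IsComposition α → flags s ≡ rowEnds α → ∃ λ T → toRibbon T ≡ s × shape T ≡ α
fromRibbon [] [] _ _ = [] , refl , refl
fromRibbon (suc k ∷ α) s (_ ∷ comp) eq with splitRow k s eq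
... | x , r , s′ , refl , refl , fl with fromRibbon α s′ comp fl
...   | T , refl , refl = (x ∷ r) ∷ T , refl , refl

prependRow-replicate : ∀ k j s → prependRow (replicate (suc k) j) s ≡ replicate k (j , false) ++ (j , true) ∷ s
prependRow-replicate zero j s = refl
prependRow-replicate (suc k) j s = cong ((j , false) ∷_) (prependRow-replicate k j s)

highestFilling-row : ∀ k j bs →
  highestFilling j (replicate k false ++ true ∷ bs) ≡ replicate k (j , false) ++ (j , true) ∷ highestFilling (suc j) bs
highestFilling-row zero j bs = refl
highestFilling-row (suc k) j bs = cong ((j , false) ∷_) (highestFilling-row k j bs)

toRibbon-standardRows : ∀ j α → IsComposition α → toRibbon (standardRows j α) ≡ highestFilling j (rowEnds α)
toRibbon-standardRows j [] _ = refl
toRibbon-standardRows j (suc k ∷ α) (_ ∷ comp) = begin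
  prependRow (replicate (suc k) j) (toRibbon (standardRows (suc j) α))     ≡⟨ prependRow-replicate k j _ ⟩
  replicate k (j , false) ++ (j , true) ∷ toRibbon (standardRows (suc j) α) ≡⟨ cong (λ s → replicate k (j , false) ++ (j , true) ∷ s)
                                                                                     (toRibbon-standardRows (suc j) α comp) ⟩
  replicate k (j , false) ++ (j , true) ∷ highestFilling (suc j) (rowEnds α) ≡⟨ sym (highestFilling-row k j _) ⟩
  highestFilling j (rowEnds (suc k ∷ α))                                     ∎
  where open ≡-Reasoning

shape-standardRows : ∀ j α → shape (standardRows j α) ≡ α
shape-standardRows j [] = refl
shape-standardRows j (a ∷ α) = cong₂ _∷_ (length-replicate a) (shape-standardRows (suc j) α)

highestFilling-≥ : ∀ j bs → All (j ≤_) (entries (highestFilling j bs))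
highestFilling-≥ j [] = []
highestFilling-≥ j (b ∷ bs) = ≤-refl ∷ All.map (≤-trans (next-≥ b j)) (highestFilling-≥ (next b j) bs)

All-replicate-++ : ∀ {Q : ℕ → Set} k {j Y} → Q j → All Q (entries Y) → All Q (entries (replicate k (j , false) ++ Y))
All-replicate-++ zero _ qY = qY
All-replicate-++ (suc k) qj qY = qj ∷ All-replicate-++ k qj qY

highestFilling-< : ∀ j α → All (_< j + length α) (entries (highestFilling j (rowEnds α)))
highestFilling-< j [] = []
highestFilling-< j (a ∷ α) rewrite highestFilling-row (a ∸ 1) j (rowEnds α) =
  All-replicate-++ (a ∸ 1) j< (j< ∷ All.map (λ {v} → subst (v <_) (sym (+-suc j (length α)))) (highestFilling-< (suc j) α))
  where
  j< : j < j + length (a ∷ α)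
  j< = m<m+n j z<s

highestFilling-tableau : ∀ n α → length α ≤ n → RibbonTableau n (rowEnds α) (highestFilling 1 (rowEnds α))
highestFilling-tableau n α ℓ≤n = record
  { quasiRibbon = highestFilling-quasiRibbon 1 (rowEnds α)
  ; flags≡ = flags-highestFilling 1 (rowEnds α)
  ; letters = All.zipWith (λ (1≤v , v<) → 1≤v , ≤-trans (≤-pred v<) ℓ≤n)
                          (highestFilling-≥ 1 (rowEnds α) , highestFilling-< 1 α)
  }

QRWord⇒Represented : ∀ {n α w} → QRWordOfShape n α w → Represented n (rowEnds α) w
QRWord⇒Represented (inAlphabet , T , qrt , refl , refl) = toRibbon T , t , columnReading-toRibbon T shapeComp
  where
  open IsQuasiRibbonTableau qrt
  fromCells : ∀ {p} → p ∈ ribbonCells 0 0 (toRibbon T) → p ∈ cells T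
  fromCells = subst (_ ∈_) (sym (cells-toRibbon 0 0 T shapeComp))
  t : RibbonTableau _ _ (toRibbon T)
  t = record
    { quasiRibbon = ribbonCells⇒quasiRibbon 0 0 (toRibbon T)
        (λ p q → rowsWeak (fromCells p) (fromCells q)) (λ p q → colsStrict (fromCells p) (fromCells q))
    ; flags≡ = flags-toRibbon T shapeComp
    ; letters = All-reading⁻ (toRibbon T) (subst (All _) (columnReading-toRibbon T shapeComp) inAlphabet)
    }

Represented⇒QRWord : ∀ {n α w} → IsComposition α → Represented n (rowEnds α) w → QRWordOfShape n α w
Represented⇒QRWord {n} {α} comp (s , t , refl) with fromRibbon α s comp (flags≡ t)
... | T , refl , refl = All-reading⁺ (toRibbon T) (letters t) , T , qrt , refl , columnReading-toRibbon T comp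
  where
  toCells : ∀ {p} → p ∈ cells T → p ∈ ribbonCells 0 0 (toRibbon T)
  toCells = subst (_ ∈_) (cells-toRibbon 0 0 T comp)
  qrt : IsQuasiRibbonTableau T
  qrt = record
    { shapeComp = comp
    ; positive = λ p∈ → proj₁ (All.lookup (letters t)
        (subst (_ ∈_) (entries-ribbonCells 0 0 _) (∈-map⁺ entry (toCells p∈))))
    ; rowsWeak = λ p q → quasiRibbon⇒rowsWeak 0 0 _ (quasiRibbon t) (toCells p) (toCells q)
    ; colsStrict = λ p q → quasiRibbon⇒colsStrict 0 0 _ (quasiRibbon t) (toCells p) (toCells q)
    }

proposition6p4 : (n : ℕ) (α : List ℕ) → IsComposition α → length α ≤ n →
    (Σ Word (λ w → QRWordOfShape n α w)
      × (∀ u → QRWordOfShape n α u → ∀ v → (QRWordOfShape n α v ⇔ Connected n u v)))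
    × (∀ w → (QRWordOfShape n α w × HighestWeight n w) ⇔ (w ≡ columnReading (highestTableau α)))
proposition6p4 n α comp ℓα≤n = ((w₀ , w₀-qr) , component) , highest
  where
  w₀ = columnReading (highestTableau α)
  w₀≡ : w₀ ≡ reading (highestFilling 1 (rowEnds α))
  w₀≡ = trans (columnReading-toRibbon (highestTableau α) (subst IsComposition (sym (shape-standardRows 1 α)) comp))
              (cong reading (toRibbon-standardRows 1 α comp))
  w₀-qr : QRWordOfShape n α w₀
  w₀-qr = Represented⇒QRWord comp (_ , highestFilling-tableau n α ℓα≤n , w₀≡)
  component : ∀ u → QRWordOfShape n α u → ∀ v → QRWordOfShape n α v ⇔ Connected n u v
  component u qu v = mk⇔ (Represented-connected (QRWord⇒Represented qu) ∘ QRWord⇒Represented)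
                         (Represented⇒QRWord comp ∘ λ c → Represented-closed c (QRWord⇒Represented qu))
  highest : ∀ w → (QRWordOfShape n α w × HighestWeight n w) ⇔ (w ≡ w₀)
  highest w = mk⇔ (λ (qw , hw) → trans (highestWeight-unique (QRWord⇒Represented qw) hw) (sym w₀≡))
                  λ { refl → w₀-qr , subst (HighestWeight n) (sym w₀≡) (highestFilling-highestWeight n (rowEnds α)) }
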